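{- Let $(P_1,\le_1)\xleftarrow{f}(P_0,\le_0)\xrightarrow{g}(P_2,\le_2)$ be a span in $\mathbf{Posets}$ with $f\in\mathcal{M}$. Then there is a pushout $(P_1,\le_1)\xrightarrow{g'}(P_3,\le_3)\xleftarrow{f'}(P_2,\le_2)$ in $\mathbf{Posets}$ such that the underlying square of sets $P_1\xrightarrow{g'}P_3\xleftarrow{f'}P_2$ is a pushout of $P_1\xleftarrow{f}P_0\xrightarrow{g}P_2$ in the category of sets. Moreover, $\mathcal{M}$ is stable under pushouts, i.e. $f'\in\mathcal{M}$.
   Context: $\mathbf{Posets}$ is the category of partially ordered sets and order-preserving maps. The class $\mathcal{M}$ consists of the strict order embeddings: order-preserving maps $f:(P,\le_P)\to(P',\le_{P'})$ such that (i) for all $x,y\in P$, $x\le_P y$ if and only if $f(x)\le_{P'}f(y)$, and (ii) for all $x,y\in P$ and each $z'\in P'$ with $f(x)\le_{P'}z'\le_{P'}f(y)$ there exists $z\in P$ with $f(z)=z'$. -}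

module Defs where

open import Level using (Level; _⊔_; suc)
open import Data.Product using (Σ; Σ-syntax; ∃; ∃-syntax; _×_; _,_)
open import Function.Bundles using (Func)
open import Relation.Binary.Bundles using (Setoid; Poset)
open import Relation.Binary.Morphism.Bundles using (PosetHomomorphism)

Hom : ∀ {ℓ} → Poset ℓ ℓ ℓ → Poset ℓ ℓ ℓ → Set ℓ
Hom P Q = PosetHomomorphism P Q

app : ∀ {ℓ} {P Q : Poset ℓ ℓ ℓ} → Hom P Q → Poset.Carrier P → Poset.Carrier Q
app h = PosetHomomorphism.⟦_⟧ h

U : ∀ {ℓ} → Poset ℓ ℓ ℓ → Setoid ℓ ℓ
U P = Poset.Eq.setoid P

UHom : ∀ {ℓ} {P Q : Poset ℓ ℓ ℓ} → Hom P Q → Func (U P) (U Q)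
UHom h = record { to = PosetHomomorphism.⟦_⟧ h ; cong = PosetHomomorphism.cong h }

IsStrictEmbedding : ∀ {ℓ} {P Q : Poset ℓ ℓ ℓ} → Hom P Q → Set ℓ
IsStrictEmbedding {P = P} {Q = Q} f =
  (∀ x y → (x P.≤ y → app f x Q.≤ app f y) × (app f x Q.≤ app f y → x P.≤ y))
  × (∀ x y (z′ : Q.Carrier) → app f x Q.≤ z′ → z′ Q.≤ app f y →
       Σ[ z ∈ P.Carrier ] app f z Q.≈ z′)
  where
    module P = Poset P
    module Q = Poset Q

IsSetPushout : ∀ {ℓ} {S₀ S₁ S₂ S₃ : Setoid ℓ ℓ}
  (f : Func S₀ S₁) (g : Func S₀ S₂) (g′ : Func S₁ S₃) (f′ : Func S₂ S₃) → Set (suc ℓ)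
IsSetPushout {ℓ} {S₀} {S₁} {S₂} {S₃} f g g′ f′ =
  (∀ x → Setoid._≈_ S₃ (to g′ (to f x)) (to f′ (to g x)))
  × ((X : Setoid ℓ ℓ) (h₁ : Func S₁ X) (h₂ : Func S₂ X) →
       (∀ x → Setoid._≈_ X (to h₁ (to f x)) (to h₂ (to g x))) →
       Σ[ u ∈ Func S₃ X ]
         ((∀ y → Setoid._≈_ X (to u (to g′ y)) (to h₁ y))
         × (∀ y → Setoid._≈_ X (to u (to f′ y)) (to h₂ y))
         × ((v : Func S₃ X) →
              (∀ y → Setoid._≈_ X (to v (to g′ y)) (to h₁ y)) →
              (∀ y → Setoid._≈_ X (to v (to f′ y)) (to h₂ y)) →
              ∀ w → Setoid._≈_ X (to v w) (to u w))))
  where open Func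

IsPosetPushout : ∀ {ℓ} {P₀ P₁ P₂ P₃ : Poset ℓ ℓ ℓ}
  (f : Hom P₀ P₁) (g : Hom P₀ P₂) (g′ : Hom P₁ P₃) (f′ : Hom P₂ P₃) → Set (suc ℓ)
IsPosetPushout {ℓ} {P₀} {P₁} {P₂} {P₃} f g g′ f′ =
  (∀ x → Poset._≈_ P₃ (app g′ (app f x)) (app f′ (app g x)))
  × ((Q : Poset ℓ ℓ ℓ) (h₁ : Hom P₁ Q) (h₂ : Hom P₂ Q) →
       (∀ x → Poset._≈_ Q (app h₁ (app f x)) (app h₂ (app g x))) →
       Σ[ u ∈ Hom P₃ Q ]
         ((∀ y → Poset._≈_ Q (app u (app g′ y)) (app h₁ y))
         × (∀ y → Poset._≈_ Q (app u (app f′ y)) (app h₂ y))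
         × ((v : Hom P₃ Q) →
              (∀ y → Poset._≈_ Q (app v (app g′ y)) (app h₁ y)) →
              (∀ y → Poset._≈_ Q (app v (app f′ y)) (app h₂ y)) →
              ∀ w → Poset._≈_ Q (app v w) (app u w))))

module Submission where

-- The pushout P₃ is carried by the disjoint union P₁ ⊎ P₂.  Besides the
-- orders of P₁ and P₂, an element may lie below another by passing through
-- the glued part: a ∈ P₁ lies below c ∈ P₂ when a ≤ f x and g x ≤ c for some
-- x ∈ P₀ ('Up'), symmetrically c lies below a ('Down'), and a lies below a′
-- by going up into P₂ and back down ('Detour').  Equality in P₃ is the
-- equivalence induced by this preorder.
--
-- Module 'Gluing' needs only that f reflects the order: then 'Down' followed
-- by 'Up' stays inside P₂, which gives transitivity, and P₃ is the pushout in
-- Posets.  Its submodule 'Convex' adds the convexity of the image of f: an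
-- element squeezed between two images is itself an image, so P₃ identifies
-- only points glued along P₀.  This makes P₃ the pushout of underlying sets
-- and makes the coprojection of P₂ a strict order embedding.

open import Defs
open import Data.Product using (Σ; Σ-syntax; _×_; _,_; proj₁; proj₂)
open import Data.Sum using (_⊎_; inj₁; inj₂)
open import Function.Bundles using (Func)
open import Relation.Binary.Bundles using (Poset; Setoid)
open import Relation.Binary.Morphism.Bundles using (PosetHomomorphism; mkPosetHomo)
import Relation.Binary.Reasoning.Setoid as SetoidReasoning

module Gluing {ℓ} {P₀ P₁ P₂ : Poset ℓ ℓ ℓ} (f : Hom P₀ P₁) (g : Hom P₀ P₂)
    (reflects : ∀ {x y} → Poset._≤_ P₁ (app f x) (app f y) → Poset._≤_ P₀ x y) where
  module A = Poset P₀
  module B = Poset P₁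
  module C = Poset P₂

  F : A.Carrier → B.Carrier
  F = app f

  G : A.Carrier → C.Carrier
  G = app g

  F≤F⇒G≤G : ∀ {x y} → F x B.≤ F y → G x C.≤ G y
  F≤F⇒G≤G p = PosetHomomorphism.mono g (reflects p)

  Up : B.Carrier → C.Carrier → Set ℓ
  Up a c = Σ[ x ∈ A.Carrier ] (a B.≤ F x × G x C.≤ c)

  Down : C.Carrier → B.Carrier → Set ℓ
  Down c a = Σ[ x ∈ A.Carrier ] (c C.≤ G x × F x B.≤ a)

  Detour : B.Carrier → B.Carrier → Set ℓ
  Detour a a′ = Σ[ c ∈ C.Carrier ] (Up a c × Down c a′)

  Up-resp : ∀ {a a′ c c′} → a′ B.≤ a → Up a c → c C.≤ c′ → Up a′ c′
  Up-resp p (x , a≤Fx , Gx≤c) q = x , B.trans p a≤Fx , C.trans Gx≤c q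

  Down-resp : ∀ {c c′ a a′} → c′ C.≤ c → Down c a → a B.≤ a′ → Down c′ a′
  Down-resp p (x , c≤Gx , Fx≤a) q = x , C.trans p c≤Gx , B.trans Fx≤a q

  Detour-resp : ∀ {a a′ b b′} → a′ B.≤ a → Detour a b → b B.≤ b′ → Detour a′ b′
  Detour-resp p (c , u , d) q = c , Up-resp p u C.refl , Down-resp C.refl d q

  Up-image : ∀ {z c} → Up (F z) c → G z C.≤ c
  Up-image (x , Fz≤Fx , Gx≤c) = C.trans (F≤F⇒G≤G Fz≤Fx) Gx≤c

  Down-image : ∀ {c z} → Down c (F z) → c C.≤ G z
  Down-image (x , c≤Gx , Fx≤Fz) = C.trans c≤Gx (F≤F⇒G≤G Fx≤Fz)

  Down-Up : ∀ {c a c′} → Down c a → Up a c′ → c C.≤ c′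
  Down-Up d (y , a≤Fy , Gy≤c′) = C.trans (Down-image (Down-resp C.refl d a≤Fy)) Gy≤c′

  Carrier₃ : Set ℓ
  Carrier₃ = B.Carrier ⊎ C.Carrier

  _≤₃_ : Carrier₃ → Carrier₃ → Set ℓ
  inj₁ a ≤₃ inj₁ a′ = a B.≤ a′ ⊎ Detour a a′
  inj₁ a ≤₃ inj₂ c  = Up a c
  inj₂ c ≤₃ inj₁ a  = Down c a
  inj₂ c ≤₃ inj₂ c′ = c C.≤ c′

  refl₃ : ∀ {u} → u ≤₃ u
  refl₃ {inj₁ a} = inj₁ B.refl
  refl₃ {inj₂ c} = C.refl

  trans₃ : ∀ {u v w} → u ≤₃ v → v ≤₃ w → u ≤₃ w
  trans₃ {inj₁ _} {inj₁ _} {inj₁ _} (inj₁ p) (inj₁ q) = inj₁ (B.trans p q)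
  trans₃ {inj₁ _} {inj₁ _} {inj₁ _} (inj₁ p) (inj₂ δ) = inj₂ (Detour-resp p δ B.refl)
  trans₃ {inj₁ _} {inj₁ _} {inj₁ _} (inj₂ δ) (inj₁ q) = inj₂ (Detour-resp B.refl δ q)
  trans₃ {inj₁ _} {inj₁ _} {inj₁ _} (inj₂ (c , u , d)) (inj₂ (_ , u′ , d′)) =
    inj₂ (c , u , Down-resp (Down-Up d u′) d′ B.refl)
  trans₃ {inj₁ _} {inj₁ _} {inj₂ _} (inj₁ p) u = Up-resp p u C.refl
  trans₃ {inj₁ _} {inj₁ _} {inj₂ _} (inj₂ (_ , u , d)) u′ = Up-resp B.refl u (Down-Up d u′)
  trans₃ {inj₁ _} {inj₂ _} {inj₁ _} u d = inj₂ (_ , u , d)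
  trans₃ {inj₁ _} {inj₂ _} {inj₂ _} u q = Up-resp B.refl u q
  trans₃ {inj₂ _} {inj₁ _} {inj₁ _} d (inj₁ q) = Down-resp C.refl d q
  trans₃ {inj₂ _} {inj₁ _} {inj₁ _} d (inj₂ (_ , u , d′)) = Down-resp (Down-Up d u) d′ B.refl
  trans₃ {inj₂ _} {inj₁ _} {inj₂ _} d u = Down-Up d u
  trans₃ {inj₂ _} {inj₂ _} {inj₁ _} q d = Down-resp q d B.refl
  trans₃ {inj₂ _} {inj₂ _} {inj₂ _} p q = C.trans p q

  _≈₃_ : Carrier₃ → Carrier₃ → Set ℓ
  u ≈₃ v = u ≤₃ v × v ≤₃ u

  P₃ : Poset ℓ ℓ ℓ
  P₃ = record
    { Carrier = Carrier₃ ; _≈_ = _≈₃_ ; _≤_ = _≤₃_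
    ; isPartialOrder = record
      { isPreorder = record
        { isEquivalence = record
          { refl  = λ {u} → refl₃ {u} , refl₃ {u}
          ; sym   = λ (p , q) → q , p
          ; trans = λ {u} {v} {w} (p , p′) (q , q′) →
                      trans₃ {u} {v} {w} p q , trans₃ {w} {v} {u} q′ p′ }
        ; reflexive = proj₁
        ; trans = λ {u} {v} {w} → trans₃ {u} {v} {w} }
      ; antisym = _,_ } }

  g′ : Hom P₁ P₃
  g′ = mkPosetHomo P₁ P₃ inj₁ inj₁

  f′ : Hom P₂ P₃
  f′ = mkPosetHomo P₂ P₃ inj₂ (λ p → p)

  square : ∀ z → inj₁ (F z) ≈₃ inj₂ (G z)
  square z = (z , B.refl , C.refl) , (z , C.refl , B.refl)

  module PosetCocone (Q : Poset ℓ ℓ ℓ) (h₁ : Hom P₁ Q) (h₂ : Hom P₂ Q)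
      (commutes : ∀ x → Poset._≈_ Q (app h₁ (F x)) (app h₂ (G x))) where
    module Q = Poset Q
    open PosetHomomorphism h₁ renaming (mono to mono₁)
    open PosetHomomorphism h₂ renaming (mono to mono₂)

    up-sends : ∀ {a c} → Up a c → app h₁ a Q.≤ app h₂ c
    up-sends (x , a≤Fx , Gx≤c) =
      Q.trans (mono₁ a≤Fx) (Q.trans (Q.reflexive (commutes x)) (mono₂ Gx≤c))

    down-sends : ∀ {c a} → Down c a → app h₂ c Q.≤ app h₁ a
    down-sends (x , c≤Gx , Fx≤a) =
      Q.trans (mono₂ c≤Gx) (Q.trans (Q.reflexive (Q.Eq.sym (commutes x))) (mono₁ Fx≤a))

    mediate : Carrier₃ → Q.Carrier
    mediate (inj₁ a) = app h₁ a
    mediate (inj₂ c) = app h₂ c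

    mediate-mono : ∀ {u v} → u ≤₃ v → mediate u Q.≤ mediate v
    mediate-mono {inj₁ _} {inj₁ _} (inj₁ p) = mono₁ p
    mediate-mono {inj₁ _} {inj₁ _} (inj₂ (_ , u , d)) = Q.trans (up-sends u) (down-sends d)
    mediate-mono {inj₁ _} {inj₂ _} u = up-sends u
    mediate-mono {inj₂ _} {inj₁ _} d = down-sends d
    mediate-mono {inj₂ _} {inj₂ _} p = mono₂ p

    mediator : Hom P₃ Q
    mediator = mkPosetHomo P₃ Q mediate (λ {u} {v} → mediate-mono {u} {v})

  posetPushout : IsPosetPushout f g g′ f′
  posetPushout = square , λ Q h₁ h₂ commutes →
    let open PosetCocone Q h₁ h₂ commutes in
    mediator , (λ _ → Q.Eq.refl) , (λ _ → Q.Eq.refl) ,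
    λ { v v∘g′ v∘f′ (inj₁ a) → v∘g′ a ; v v∘g′ v∘f′ (inj₂ c) → v∘f′ c }

  module Convex
      (convex : ∀ {x y a} → F x B.≤ a → a B.≤ F y → Σ[ z ∈ A.Carrier ] F z B.≈ a) where

    Above : B.Carrier → Set ℓ
    Above a = Σ[ x ∈ A.Carrier ] F x B.≤ a

    Below : B.Carrier → Set ℓ
    Below a = Σ[ x ∈ A.Carrier ] a B.≤ F x

    above-transfer : ∀ {a a′} → Above a′ → inj₁ a′ ≤₃ inj₁ a → Above a
    above-transfer (x , Fx≤a′) (inj₁ p) = x , B.trans Fx≤a′ p
    above-transfer _ (inj₂ (_ , _ , (x , _ , Fx≤a))) = x , Fx≤a

    below-transfer : ∀ {a a′} → Below a → inj₁ a′ ≤₃ inj₁ a → Below a′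
    below-transfer (x , a≤Fx) (inj₁ p) = x , B.trans p a≤Fx
    below-transfer _ (inj₂ (_ , (x , a′≤Fx , _) , _)) = x , a′≤Fx

    reflect₃ : ∀ {z z′ a a′} → F z B.≈ a → F z′ B.≈ a′ → inj₁ a ≤₃ inj₁ a′ → G z C.≤ G z′
    reflect₃ {z} {z′} {a} {a′} e e′ p = between-images (transport p)
      where
      transport : inj₁ a ≤₃ inj₁ a′ → inj₁ (F z) ≤₃ inj₁ (F z′)
      transport q = trans₃ {inj₁ (F z)} {inj₁ a} {inj₁ (F z′)} (inj₁ (B.reflexive e))
                      (trans₃ {inj₁ a} {inj₁ a′} {inj₁ (F z′)} q (inj₁ (B.reflexive (B.Eq.sym e′))))

      between-images : inj₁ (F z) ≤₃ inj₁ (F z′) → G z C.≤ G z′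
      between-images (inj₁ Fz≤Fz′)      = F≤F⇒G≤G Fz≤Fz′
      between-images (inj₂ (_ , u , d)) = C.trans (Up-image u) (Down-image d)

    Glued : B.Carrier → B.Carrier → Set ℓ
    Glued a a′ = Σ[ z ∈ A.Carrier ] Σ[ z′ ∈ A.Carrier ] (F z B.≈ a × F z′ B.≈ a′ × G z C.≈ G z′)

    Glued-sym : ∀ {a a′} → Glued a a′ → Glued a′ a
    Glued-sym (z , z′ , e , e′ , eG) = z′ , z , e′ , e , C.Eq.sym eG

    detour-glues : ∀ {a a′} → Detour a a′ → inj₁ a′ ≤₃ inj₁ a → Glued a a′
    detour-glues δ@(_ , (x , a≤Fx , _) , (x′ , _ , Fx′≤a′)) q
      with convex (proj₂ (above-transfer (x′ , Fx′≤a′) q)) a≤Fx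
         | convex Fx′≤a′ (proj₂ (below-transfer (x , a≤Fx) q))
    ... | z , e | z′ , e′ = z , z′ , e , e′ , C.antisym (reflect₃ e e′ (inj₂ δ)) (reflect₃ e′ e q)

    collapse₁₁ : ∀ {a a′} → inj₁ a ≈₃ inj₁ a′ → a B.≈ a′ ⊎ Glued a a′
    collapse₁₁ (inj₁ p , inj₁ q) = inj₁ (B.antisym p q)
    collapse₁₁ (inj₂ δ , q) = inj₂ (detour-glues δ q)
    collapse₁₁ (p , inj₂ δ) = inj₂ (Glued-sym (detour-glues δ p))

    collapse₁₂ : ∀ {a c} → inj₁ a ≈₃ inj₂ c → Σ[ z ∈ A.Carrier ] (F z B.≈ a × G z C.≈ c)
    collapse₁₂ (u@(_ , a≤Fx , _) , d@(_ , _ , Fx′≤a)) with convex Fx′≤a a≤Fx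
    ... | z , e = z , e , C.antisym (Up-image (Up-resp (B.reflexive e) u C.refl))
                                    (Down-image (Down-resp C.refl d (B.reflexive (B.Eq.sym e))))

    module SetCocone (X : Setoid ℓ ℓ) (h₁ : Func (U P₁) X) (h₂ : Func (U P₂) X)
        (commutes : ∀ x → Setoid._≈_ X (Func.to h₁ (F x)) (Func.to h₂ (G x))) where
      module X = Setoid X
      open Func h₁ renaming (to to H₁; cong to cong₁)
      open Func h₂ renaming (to to H₂; cong to cong₂)
      open SetoidReasoning X

      mediate : Carrier₃ → X.Carrier
      mediate (inj₁ a) = H₁ a
      mediate (inj₂ c) = H₂ c

      across : ∀ {z a c} → F z B.≈ a → G z C.≈ c → H₁ a X.≈ H₂ c
      across {z} {a} {c} e eG = begin
        H₁ a      ≈⟨ cong₁ (B.Eq.sym e) ⟩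
        H₁ (F z)  ≈⟨ commutes z ⟩
        H₂ (G z)  ≈⟨ cong₂ eG ⟩
        H₂ c      ∎

      glued-agree : ∀ {a a′} → Glued a a′ → H₁ a X.≈ H₁ a′
      glued-agree {a} {a′} (z , z′ , e , e′ , eG) = begin
        H₁ a       ≈⟨ across e eG ⟩
        H₂ (G z′)  ≈⟨ X.sym (across e′ C.Eq.refl) ⟩
        H₁ a′      ∎

      mediate-cong : ∀ {u v} → u ≈₃ v → mediate u X.≈ mediate v
      mediate-cong {inj₁ _} {inj₁ _} eq with collapse₁₁ eq
      ... | inj₁ e  = cong₁ e
      ... | inj₂ gl = glued-agree gl
      mediate-cong {inj₁ _} {inj₂ _} eq with collapse₁₂ eq
      ... | _ , e , eG = across e eG
      mediate-cong {inj₂ _} {inj₁ _} (p , q) with collapse₁₂ (q , p)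
      ... | _ , e , eG = X.sym (across e eG)
      mediate-cong {inj₂ _} {inj₂ _} (p , q) = cong₂ (C.antisym p q)

      mediator : Func (U P₃) X
      mediator = record { to = mediate ; cong = λ {u} {v} → mediate-cong {u} {v} }

    setPushout : IsSetPushout (UHom f) (UHom g) (UHom g′) (UHom f′)
    setPushout = square , λ X h₁ h₂ commutes →
      let open SetCocone X h₁ h₂ commutes in
      mediator , (λ _ → X.refl) , (λ _ → X.refl) ,
      λ { v v∘g′ v∘f′ (inj₁ a) → v∘g′ a ; v v∘g′ v∘f′ (inj₂ c) → v∘f′ c }

    f′-convex : ∀ {c c′} (w : Carrier₃) → inj₂ c ≤₃ w → w ≤₃ inj₂ c′ →
                Σ[ c″ ∈ C.Carrier ] inj₂ c″ ≈₃ w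
    f′-convex (inj₂ c″) _ _ = c″ , C.refl , C.refl
    f′-convex (inj₁ a) (_ , _ , Fx≤a) (_ , a≤Fy , _) with convex Fx≤a a≤Fy
    ... | z , e = G z , (z , C.refl , B.reflexive e) , (z , B.reflexive (B.Eq.sym e) , C.refl)

    f′-embedding : IsStrictEmbedding f′
    f′-embedding = (λ _ _ → (λ p → p) , (λ p → p)) , (λ _ _ w → f′-convex w)

lemma5 : ∀ {ℓ} (P₀ P₁ P₂ : Poset ℓ ℓ ℓ) (f : Hom P₀ P₁) (g : Hom P₀ P₂) →
    IsStrictEmbedding f →
    Σ[ P₃ ∈ Poset ℓ ℓ ℓ ] Σ[ g′ ∈ Hom P₁ P₃ ] Σ[ f′ ∈ Hom P₂ P₃ ]
    (IsPosetPushout f g g′ f′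
    × IsSetPushout (UHom f) (UHom g) (UHom g′) (UHom f′)
    × IsStrictEmbedding f′)
lemma5 P₀ P₁ P₂ f g (order-embedding , convex) =
  P₃ , g′ , f′ , posetPushout , setPushout , f′-embedding
  where
    open Gluing f g (λ {x} {y} → proj₂ (order-embedding x y))
    open Convex (λ {x} {y} {a} → convex x y a)
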